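{- Let $n\ge 1$ and let $\mathcal F$ be a $\mathcal B$-saturated family of subsets of $[n]$ containing exactly $k\ge 1$ singletons (sets of the form $\{i\}$). Then $|\mathcal F|\ge \binom{k}{2}+k(n-k)$.
   Context: Subsets of $[n]=\{1,\dots,n\}$ are ordered by inclusion. For finite posets $\mathcal P$ and $\mathcal Q$, $\mathcal P$ contains an induced copy of $\mathcal Q$ if there is an injective map $f:\mathcal Q\to\mathcal P$ such that for all $a,b\in\mathcal Q$, $a\le b$ if and only if $f(a)\le f(b)$. A family $\mathcal F$ of subsets of $[n]$ is $\mathcal Q$-saturated if $\mathcal F$ contains no induced copy of $\mathcal Q$, but for every $S\subseteq[n]$ with $S\notin\mathcal F$, $\mathcal F\cup\{S\}$ contains an induced copy of $\mathcal Q$. The butterfly $\mathcal B$ is the four-element poset $\{a_1,a_2,b_1,b_2\}$ in which $a_1,a_2$ are incomparable, $b_1,b_2$ are incomparable, and $a_i<b_j$ for all $i,j\in\{1,2\}$ (no other relations). -}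

module Defs where

open import Data.Nat using (ℕ)
open import Data.Bool using (Bool)
open import Data.Bool.Properties using () renaming (_≟_ to _≟ᵇ_)
open import Data.Fin using (Fin; zero; suc)
open import Data.Fin.Subset using (Subset; _⊆_; ⁅_⁆)
open import Data.List using (List; length; filter; allFin)
open import Data.List.Relation.Unary.Unique.Propositional using (Unique)
open import Data.Vec.Properties using (≡-dec)
open import Data.Product using (Σ; _×_)
open import Data.Empty using (⊥)
open import Data.Unit using (⊤)
open import Function.Bundles using (_⇔_)
open import Function.Definitions using (Injective)
open import Relation.Binary.PropositionalEquality using (_≡_)
open import Relation.Nullary using (¬_)
import Data.List.Membership.DecPropositional as DecMem

record Family (n : ℕ) : Set where
  constructor family
  field
    sets   : List (Subset n)
    unique : Unique sets
open Family public

∣_∣F : ∀ {n} → Family n → ℕ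
∣ F ∣F = length (sets F)

module _ {n : ℕ} where
  open DecMem (≡-dec {n = n} _≟ᵇ_) public using (_∈_; _∈?_)

-- The butterfly poset on Fin 4 : 0 = a₁, 1 = a₂, 2 = b₁, 3 = b₂.
-- Non-strict order: reflexive, and aᵢ ≤ bⱼ.
_≤B_ : Fin 4 → Fin 4 → Set
zero ≤B zero = ⊤
zero ≤B suc zero = ⊥
zero ≤B suc (suc _) = ⊤
suc zero ≤B zero = ⊥
suc zero ≤B suc zero = ⊤
suc zero ≤B suc (suc _) = ⊤
suc (suc _) ≤B zero = ⊥
suc (suc _) ≤B suc zero = ⊥
suc (suc zero) ≤B suc (suc zero) = ⊤
suc (suc zero) ≤B suc (suc (suc _)) = ⊥
suc (suc (suc _)) ≤B suc (suc zero) = ⊥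
suc (suc (suc _)) ≤B suc (suc (suc _)) = ⊤

ContainsInducedB : ∀ {n} → List (Subset n) → Set
ContainsInducedB {n} L =
  Σ (Fin 4 → Subset n) λ f →
    Injective _≡_ _≡_ f × (∀ i → f i ∈ L) × (∀ a b → (a ≤B b) ⇔ (f a ⊆ f b))

BSaturated : ∀ {n} → Family n → Set
BSaturated {n} F =
  ¬ ContainsInducedB (sets F) ×
  (∀ (S : Subset n) → ¬ (S ∈ sets F) → ContainsInducedB (S List.∷ sets F))
  where import Data.List as List

numSingletons : ∀ {n} → Family n → ℕ
numSingletons {n} F = length (filter (λ i → ⁅ i ⁆ ∈? sets F) (allFin n))

-- Let K be the set of i with {i} ∈ F. Saturation forces {i, j} ∈ F for i, j ∈ K, and for
-- i ∈ K, x ∉ K it yields A ∈ F containing i, no other element of K and not x, with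
-- A ∪ {x} ∈ F: start from A = {i}; while A ∪ {x} ∉ F, adding it creates a butterfly in which
-- A ∪ {x} is a bottom element (it cannot be a top: at first it has two elements, later it lies
-- below two incomparable members of F), and the other bottom element is a strictly larger
-- admissible choice of A.
-- Enumerate K as i₁, …, i_k and let F_t consist of the members of F containing i_t but none
-- of i₁, …, i_{t-1}; these layers are disjoint. F_t contains edges S, S ∪ {d} in the n - k
-- directions outside K and in the k - t directions i_{t+1}, …, i_k, and a family with edges
-- in m distinct directions has more than m members (split it by the first coordinate).
-- Summing, |F| ≥ Σ_t (n - k + k - t) = k(n - k) + C(k, 2).
module Submission where

open import Defs
open import Data.Nat using (ℕ; _+_; _*_; _∸_; _≤_)
open import Data.Nat.Combinatorics using (_C_)
open import Relation.Binary.PropositionalEquality using (_≡_)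

open import Data.Nat using (zero; suc; pred; _<_; z≤n; s≤s)
open import Data.Nat.Properties
  using (≤-refl; ≤-trans; ≤-reflexive; +-suc; +-mono-≤; +-monoʳ-≤; pred[n]≤n; ∸-monoʳ-<; m+n∸m≡n; +-comm; module ≤-Reasoning)
open import Data.Nat.Induction using (<-wellFounded)
open import Data.Nat.Combinatorics using (nCk+nC[k+1]≡[n+1]C[k+1]; nC1≡n)
open import Data.Nat.Tactic.RingSolver using (solve-∀)
open import Induction.WellFounded using (Acc; acc)
open import Data.Bool using (Bool; true; false)
open import Data.Bool.Properties using () renaming (_≟_ to _≟ᵇ_)
open import Data.Vec using (_∷_)
import Data.Vec.Base as Vec
open import Data.Fin using (Fin; zero; suc)
open import Data.Fin.Properties using (¬∀⟶∃¬) renaming (_≟_ to _≟ᶠ_)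
open import Data.Fin.Subset using (Subset; _⊆_; _⊈_; _∪_; ⁅_⁆; ∣_∣)
  renaming (_∈_ to _∈ₛ_; _∉_ to _∉ₛ_)
open import Data.Fin.Subset.Properties
  using (⊆-trans; ⊆-reflexive; p⊆p∪q; q⊆p∪q; x∈p∪q⁻; x∈p∪q⁺; x∈⁅x⁆; x∈⁅y⁆⇒x≡y; _⊆?_; p⊂q⇒∣p∣<∣q∣; ∣p∣≤n)
  renaming (_∈?_ to _∈ₛ?_)
open import Data.List using (List; []; _∷_; length; filter; allFin; _++_)
open import Data.List.Properties using (length-++; length-tabulate; filter-accept; filter-reject)
open import Data.List.Relation.Unary.Any using (Any; here; there; any?)
open import Data.List.Relation.Unary.All using (All; []; _∷_; all?; tabulate; lookup)
open import Data.List.Relation.Unary.All.Properties using (All¬⇒¬Any; ¬Any⇒All¬)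
open import Data.List.Relation.Unary.Unique.Propositional using (Unique; []; _∷_; head; tail)
open import Data.List.Relation.Unary.Unique.Propositional.Properties using (filter⁺; allFin⁺; ++⁺)
open import Data.List.Relation.Binary.Disjoint.Propositional using (Disjoint)
open import Data.List.Membership.Propositional using (find; lose) renaming (_∈_ to _∈ₗ_; _∉_ to _∉ₗ_)
open import Data.List.Membership.Propositional.Properties using (∈-filter⁺; ∈-filter⁻; ∈-++⁻; ∈-length)
open import Data.Product using (_×_; _,_; proj₁; proj₂; ∃-syntax)
open import Data.Sum using (_⊎_; inj₁; inj₂; [_,_]′)
import Data.Sum as Sum
open import Data.Empty using (⊥; ⊥-elim)
open import Data.Unit using (⊤; tt)
open import Function using (_∘_; id; const)
open import Function.Bundles using (_⇔_; mk⇔; Equivalence)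
open import Function.Definitions using (Injective)
open import Relation.Nullary using (¬_; Dec; yes; no; ¬?; _×-dec_; _→-dec_)
open import Relation.Nullary.Decidable using (decidable-stable; map′)
open import Relation.Unary using (Decidable)
open import Relation.Binary.PropositionalEquality using (_≢_; refl; sym; trans; cong; cong₂; subst)

among-two : {A : Set} {a b z z₁ z₂ : A} → z₁ ≢ z₂ →
            z ≡ a ⊎ z ≡ b → z₁ ≡ a ⊎ z₁ ≡ b → z₂ ≡ a ⊎ z₂ ≡ b → z ≡ z₁ ⊎ z ≡ z₂
among-two _ (inj₁ refl) (inj₁ refl) _ = inj₁ refl
among-two _ (inj₂ refl) (inj₂ refl) _ = inj₁ refl
among-two _ (inj₁ refl) (inj₂ refl) (inj₁ refl) = inj₂ refl
among-two _ (inj₂ refl) (inj₁ refl) (inj₂ refl) = inj₂ refl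
among-two z₁≢z₂ (inj₁ refl) (inj₂ refl) (inj₂ refl) = ⊥-elim (z₁≢z₂ refl)
among-two z₁≢z₂ (inj₂ refl) (inj₁ refl) (inj₁ refl) = ⊥-elim (z₁≢z₂ refl)

module _ {n : ℕ} where

  ⊈⇒∃∈∉ : {p q : Subset n} → p ⊈ q → ∃[ z ] z ∈ₛ p × z ∉ₛ q
  ⊈⇒∃∈∉ {p} {q} p⊈q with ¬∀⟶∃¬ n _ (λ z → z ∈ₛ? p →-dec z ∈ₛ? q) (λ p⊆q → p⊈q (p⊆q _))
  ... | z , z∈p↛z∈q =
    z , decidable-stable (z ∈ₛ? p) (λ z∉p → z∈p↛z∈q (⊥-elim ∘ z∉p)) , z∈p↛z∈q ∘ const

  ∪-least : {p q r : Subset n} → p ⊆ r → q ⊆ r → p ∪ q ⊆ r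
  ∪-least {p} {q} p⊆r q⊆r x∈p∪q = [ p⊆r , q⊆r ]′ (x∈p∪q⁻ p q x∈p∪q)

  ⁅x⁆⊆p : {x : Fin n} {p : Subset n} → x ∈ₛ p → ⁅ x ⁆ ⊆ p
  ⁅x⁆⊆p {x} {p} x∈p y∈⁅x⁆ = subst (_∈ₛ p) (sym (x∈⁅y⁆⇒x≡y x y∈⁅x⁆)) x∈p

  ∈-∪⁅⁆⁻ : {x y : Fin n} (p : Subset n) → y ∈ₛ p ∪ ⁅ x ⁆ → y ∈ₛ p ⊎ y ≡ x
  ∈-∪⁅⁆⁻ {x} p y∈ = Sum.map₂ (x∈⁅y⁆⇒x≡y x) (x∈p∪q⁻ p ⁅ x ⁆ y∈)

pattern a₁ = zero
pattern a₂ = suc zero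
pattern b₁ = suc (suc zero)
pattern b₂ = suc (suc (suc zero))

≤B-antisym : ∀ {a b} → a ≤B b → b ≤B a → a ≡ b
≤B-antisym {a₁} {a₁} _ _ = refl
≤B-antisym {a₂} {a₂} _ _ = refl
≤B-antisym {b₁} {b₁} _ _ = refl
≤B-antisym {b₂} {b₂} _ _ = refl
≤B-antisym {a₁} {a₂} () _
≤B-antisym {a₁} {b₁} _ ()
≤B-antisym {a₁} {b₂} _ ()
≤B-antisym {a₂} {a₁} () _
≤B-antisym {a₂} {b₁} _ ()
≤B-antisym {a₂} {b₂} _ ()
≤B-antisym {b₁} {a₁} () _
≤B-antisym {b₁} {a₂} () _
≤B-antisym {b₁} {b₂} () _
≤B-antisym {b₂} {a₁} () _
≤B-antisym {b₂} {a₂} () _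
≤B-antisym {b₂} {b₁} () _

module _ {n : ℕ} where

  record Cap (L : List (Subset n)) (T : Subset n) : Set where
    constructor cap
    field
      {B₁ B₂} : Subset n
      B₁∈L : B₁ ∈ L
      B₂∈L : B₂ ∈ L
      B₁⊈B₂ : B₁ ⊈ B₂
      B₂⊈B₁ : B₂ ⊈ B₁
      T⊆B₁ : T ⊆ B₁
      T⊆B₂ : T ⊆ B₂

  Cap-⊆ : {L : List (Subset n)} {T T' : Subset n} → T ⊆ T' → Cap L T' → Cap L T
  Cap-⊆ T⊆T' (cap B₁∈L B₂∈L B₁⊈B₂ B₂⊈B₁ T'⊆B₁ T'⊆B₂) =
    cap B₁∈L B₂∈L B₁⊈B₂ B₂⊈B₁ (⊆-trans T⊆T' T'⊆B₁) (⊆-trans T⊆T' T'⊆B₂)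

  butterfly : {L : List (Subset n)} {A A' : Subset n} → A ∈ L → A' ∈ L → A ⊈ A' → A' ⊈ A →
              Cap L (A ∪ A') → ContainsInducedB L
  butterfly {L} {A} {A'} A∈L A'∈L A⊈A' A'⊈A (cap {B₁} {B₂} B₁∈L B₂∈L B₁⊈B₂ B₂⊈B₁ A∪A'⊆B₁ A∪A'⊆B₂) =
    f , injective , f∈L , order
    where
    f : Fin 4 → Subset n
    f a₁ = A
    f a₂ = A'
    f b₁ = B₁
    f b₂ = B₂

    f∈L : ∀ a → f a ∈ L
    f∈L a₁ = A∈L
    f∈L a₂ = A'∈L
    f∈L b₁ = B₁∈L
    f∈L b₂ = B₂∈L

    A⊆B₁ : A ⊆ B₁
    A⊆B₁ = ⊆-trans (p⊆p∪q A') A∪A'⊆B₁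
    A⊆B₂ : A ⊆ B₂
    A⊆B₂ = ⊆-trans (p⊆p∪q A') A∪A'⊆B₂
    A'⊆B₁ : A' ⊆ B₁
    A'⊆B₁ = ⊆-trans (q⊆p∪q A A') A∪A'⊆B₁
    A'⊆B₂ : A' ⊆ B₂
    A'⊆B₂ = ⊆-trans (q⊆p∪q A A') A∪A'⊆B₂

    B₁⊈ : ∀ {X} → X ⊆ B₂ → B₁ ⊈ X
    B₁⊈ X⊆B₂ B₁⊆X = B₁⊈B₂ (⊆-trans B₁⊆X X⊆B₂)
    B₂⊈ : ∀ {X} → X ⊆ B₁ → B₂ ⊈ X
    B₂⊈ X⊆B₁ B₂⊆X = B₂⊈B₁ (⊆-trans B₂⊆X X⊆B₁)

    holds : ∀ {p q : Subset n} → p ⊆ q → ⊤ ⇔ (p ⊆ q)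
    holds p⊆q = mk⇔ (λ _ {x} → p⊆q {x}) (const tt)
    fails : ∀ {p q : Subset n} → p ⊈ q → ⊥ ⇔ (p ⊆ q)
    fails p⊈q = mk⇔ ⊥-elim p⊈q

    order : ∀ a b → (a ≤B b) ⇔ (f a ⊆ f b)
    order a₁ a₁ = holds (λ x → x)
    order a₁ a₂ = fails A⊈A'
    order a₁ b₁ = holds A⊆B₁
    order a₁ b₂ = holds A⊆B₂
    order a₂ a₁ = fails A'⊈A
    order a₂ a₂ = holds (λ x → x)
    order a₂ b₁ = holds A'⊆B₁
    order a₂ b₂ = holds A'⊆B₂
    order b₁ a₁ = fails (B₁⊈ A⊆B₂)
    order b₁ a₂ = fails (B₁⊈ A'⊆B₂)
    order b₁ b₁ = holds (λ x → x)
    order b₁ b₂ = fails B₁⊈B₂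
    order b₂ a₁ = fails (B₂⊈ A⊆B₁)
    order b₂ a₂ = fails (B₂⊈ A'⊆B₁)
    order b₂ b₁ = fails B₂⊈B₁
    order b₂ b₂ = holds (λ x → x)

    injective : Injective _≡_ _≡_ f
    injective {a} {b} fa≡fb = ≤B-antisym (Equivalence.from (order a b) (⊆-reflexive fa≡fb))
                                         (Equivalence.from (order b a) (⊆-reflexive (sym fa≡fb)))

  record ButterflyBottom (L : List (Subset n)) (S : Subset n) : Set where
    constructor bottom
    field
      {Y} : Subset n
      Y∈L : Y ∈ L
      S⊈Y : S ⊈ Y
      Y⊈S : Y ⊈ S
      capped : Cap L (S ∪ Y)

  record ButterflyTop (L : List (Subset n)) (S : Subset n) : Set where
    constructor top
    field
      {X₁ X₂ B} : Subset n
      X₁∈L : X₁ ∈ L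
      X₂∈L : X₂ ∈ L
      B∈L : B ∈ L
      X₁⊈X₂ : X₁ ⊈ X₂
      X₂⊈X₁ : X₂ ⊈ X₁
      S⊈B : S ⊈ B
      B⊈S : B ⊈ S
      X₁∪X₂⊆S : X₁ ∪ X₂ ⊆ S
      X₁∪X₂⊆B : X₁ ∪ X₂ ⊆ B

  new-butterfly : {L : List (Subset n)} {S : Subset n} → ¬ ContainsInducedB L →
                  ContainsInducedB (S ∷ L) → ButterflyBottom L S ⊎ ButterflyTop L S
  new-butterfly {L} no-butterfly (f , f-injective , f∈ , order) = classify (f∈ a₁) (f∈ a₂) (f∈ b₁) (f∈ b₂)
    where
    f-mono : ∀ a b → a ≤B b → f a ⊆ f b
    f-mono a b = Equivalence.to (order a b)
    f-reflects : ∀ a b → f a ⊆ f b → a ≤B b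
    f-reflects a b = Equivalence.from (order a b)

    f∪f⊆ : ∀ a a' b → a ≤B b → a' ≤B b → f a ∪ f a' ⊆ f b
    f∪f⊆ a a' b a≤b a'≤b = ∪-least (f-mono a b a≤b) (f-mono a' b a'≤b)

    drop : ∀ {a b} → a ≢ b → f b ∈ (f a ∷ L) → f b ∈ L
    drop a≢b (here fb≡fa) = ⊥-elim (a≢b (f-injective (sym fb≡fa)))
    drop _ (there fb∈L) = fb∈L

    classify : ∀ {S} → f a₁ ∈ (S ∷ L) → f a₂ ∈ (S ∷ L) → f b₁ ∈ (S ∷ L) → f b₂ ∈ (S ∷ L) →
               ButterflyBottom L S ⊎ ButterflyTop L S
    classify (here refl) a₂∈ b₁∈ b₂∈ =
      inj₁ (bottom (drop (λ ()) a₂∈) (f-reflects a₁ a₂) (f-reflects a₂ a₁)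
        (cap (drop (λ ()) b₁∈) (drop (λ ()) b₂∈) (f-reflects b₁ b₂) (f-reflects b₂ b₁)
             (f∪f⊆ a₁ a₂ b₁ tt tt) (f∪f⊆ a₁ a₂ b₂ tt tt)))
    classify (there a₁∈) (here refl) b₁∈ b₂∈ =
      inj₁ (bottom a₁∈ (f-reflects a₂ a₁) (f-reflects a₁ a₂)
        (cap (drop (λ ()) b₁∈) (drop (λ ()) b₂∈) (f-reflects b₁ b₂) (f-reflects b₂ b₁)
             (f∪f⊆ a₂ a₁ b₁ tt tt) (f∪f⊆ a₂ a₁ b₂ tt tt)))
    classify (there a₁∈) (there a₂∈) (here refl) b₂∈ =
      inj₂ (top a₁∈ a₂∈ (drop (λ ()) b₂∈) (f-reflects a₁ a₂) (f-reflects a₂ a₁)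
        (f-reflects b₁ b₂) (f-reflects b₂ b₁) (f∪f⊆ a₁ a₂ b₁ tt tt) (f∪f⊆ a₁ a₂ b₂ tt tt))
    classify (there a₁∈) (there a₂∈) (there b₁∈) (here refl) =
      inj₂ (top a₁∈ a₂∈ b₁∈ (f-reflects a₁ a₂) (f-reflects a₂ a₁)
        (f-reflects b₂ b₁) (f-reflects b₁ b₂) (f∪f⊆ a₁ a₂ b₂ tt tt) (f∪f⊆ a₁ a₂ b₁ tt tt))
    classify (there a₁∈) (there a₂∈) (there b₁∈) (there b₂∈) =
      ⊥-elim (no-butterfly (f , f-injective , f∈L , order))
      where
      f∈L : ∀ a → f a ∈ L
      f∈L a₁ = a₁∈
      f∈L a₂ = a₂∈
      f∈L b₁ = b₁∈
      f∈L b₂ = b₂∈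

  pair-not-top : {L : List (Subset n)} (a b : Fin n) → ¬ ButterflyTop L (⁅ a ⁆ ∪ ⁅ b ⁆)
  pair-not-top a b (top {X₁} {X₂} _ _ _ X₁⊈X₂ X₂⊈X₁ S⊈B _ X₁∪X₂⊆S X₁∪X₂⊆B)
    with ⊈⇒∃∈∉ X₁⊈X₂ | ⊈⇒∃∈∉ X₂⊈X₁
  ... | z₁ , z₁∈X₁ , z₁∉X₂ | z₂ , z₂∈X₂ , _ = S⊈B (X₁∪X₂⊆B ∘ x∈p∪q⁺ ∘ z∈X₁⊎z∈X₂)
    where
    elements : ∀ {z} → z ∈ₛ ⁅ a ⁆ ∪ ⁅ b ⁆ → z ≡ a ⊎ z ≡ b
    elements z∈ = Sum.map (x∈⁅y⁆⇒x≡y a) (x∈⁅y⁆⇒x≡y b) (x∈p∪q⁻ ⁅ a ⁆ ⁅ b ⁆ z∈)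

    z∈X₁⊎z∈X₂ : ∀ {z} → z ∈ₛ ⁅ a ⁆ ∪ ⁅ b ⁆ → z ∈ₛ X₁ ⊎ z ∈ₛ X₂
    z∈X₁⊎z∈X₂ z∈ =
      Sum.map (λ { refl → z₁∈X₁ }) (λ { refl → z₂∈X₂ })
        (among-two (λ { refl → z₁∉X₂ z₂∈X₂ }) (elements z∈)
          (elements (X₁∪X₂⊆S (p⊆p∪q X₂ z₁∈X₁))) (elements (X₁∪X₂⊆S (q⊆p∪q X₁ X₂ z₂∈X₂))))

module Saturated {n : ℕ} {L : List (Subset n)} (no-butterfly : ¬ ContainsInducedB L)
                 (saturated : ∀ S → ¬ (S ∈ L) → ContainsInducedB (S ∷ L)) where

  bottom-or-top : {S : Subset n} → ¬ (S ∈ L) → ButterflyBottom L S ⊎ ButterflyTop L S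
  bottom-or-top S∉L = new-butterfly no-butterfly (saturated _ S∉L)

  ¬top-under-cap : {T : Subset n} → Cap L T → ¬ ButterflyTop L T
  ¬top-under-cap κ (top X₁∈L X₂∈L _ X₁⊈X₂ X₂⊈X₁ _ _ X₁∪X₂⊆T _) =
    no-butterfly (butterfly X₁∈L X₂∈L X₁⊈X₂ X₂⊈X₁ (Cap-⊆ X₁∪X₂⊆T κ))

  open ButterflyBottom

  ⊆-bottom-partner : {A S : Subset n} → A ∈ L → A ⊆ S → (β : ButterflyBottom L S) → A ⊆ Y β
  ⊆-bottom-partner {A} {S} A∈L A⊆S (bottom {Y} Y∈L _ Y⊈S κ) = decidable-stable (A ⊆? Y) λ A⊈Y →
    no-butterfly (butterfly A∈L Y∈L A⊈Y (λ Y⊆A → Y⊈S (⊆-trans Y⊆A A⊆S))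
      (Cap-⊆ (∪-least (⊆-trans A⊆S (p⊆p∪q Y)) (q⊆p∪q S Y)) κ))

  pair∈ : {i j : Fin n} → ⁅ i ⁆ ∈ L → ⁅ j ⁆ ∈ L → ⁅ i ⁆ ∪ ⁅ j ⁆ ∈ L
  pair∈ {i} {j} ⁅i⁆∈L ⁅j⁆∈L = decidable-stable (⁅ i ⁆ ∪ ⁅ j ⁆ ∈? L) λ pair∉L →
    [ (λ β → S⊈Y β (∪-least (⊆-bottom-partner ⁅i⁆∈L (p⊆p∪q ⁅ j ⁆) β)
                            (⊆-bottom-partner ⁅j⁆∈L (q⊆p∪q ⁅ i ⁆ ⁅ j ⁆) β)))
    , pair-not-top i j ]′ (bottom-or-top pair∉L)

  record Anchored (i x : Fin n) (A : Subset n) : Set where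
    field
      A∈L : A ∈ L
      i∈A : i ∈ₛ A
      x∉A : x ∉ₛ A
      only-i : ∀ {j} → ⁅ j ⁆ ∈ L → j ∈ₛ A → j ≡ i

  module _ {i x : Fin n} {A : Subset n} (α : Anchored i x A) (β : ButterflyBottom L (A ∪ ⁅ x ⁆)) where
    open Anchored α

    A⊆partner : A ⊆ Y β
    A⊆partner = ⊆-bottom-partner A∈L (p⊆p∪q ⁅ x ⁆) β

    partner-anchored : Anchored i x (Y β)
    partner-anchored = record
      { A∈L = Y∈L β
      ; i∈A = A⊆partner i∈A
      ; x∉A = λ x∈Y → S⊈Y β (∪-least A⊆partner (⁅x⁆⊆p x∈Y))
      ; only-i = λ {j} ⁅j⁆∈L j∈Y → decidable-stable (j ≟ᶠ i) λ j≢i →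
          no-butterfly (butterfly ⁅j⁆∈L A∈L
            (λ ⁅j⁆⊆A → j≢i (only-i ⁅j⁆∈L (⁅j⁆⊆A (x∈⁅x⁆ j))))
            (λ A⊆⁅j⁆ → j≢i (sym (x∈⁅y⁆⇒x≡y j (A⊆⁅j⁆ i∈A))))
            (Cap-⊆ (∪-least (⁅x⁆⊆p (q⊆p∪q (A ∪ ⁅ x ⁆) (Y β) j∈Y))
                            (⊆-trans (p⊆p∪q ⁅ x ⁆) (p⊆p∪q (Y β))))
                   (capped β)))
      }

    partner-larger : ∣ A ∣ < ∣ Y β ∣
    partner-larger with ⊈⇒∃∈∉ (Y⊈S β)
    ... | z , z∈Y , z∉S = p⊂q⇒∣p∣<∣q∣ (A⊆partner , z , z∈Y , z∉S ∘ p⊆p∪q ⁅ x ⁆)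

    partner-capped : Cap L (Y β ∪ ⁅ x ⁆)
    partner-capped = Cap-⊆ (∪-least (q⊆p∪q (A ∪ ⁅ x ⁆) (Y β)) (⊆-trans (q⊆p∪q A ⁅ x ⁆) (p⊆p∪q (Y β))))
                           (capped β)

  anchored-edge : {i x : Fin n} → ⁅ i ⁆ ∈ L → ¬ (⁅ x ⁆ ∈ L) → ∃[ A ] Anchored i x A × A ∪ ⁅ x ⁆ ∈ L
  anchored-edge {i} {x} ⁅i⁆∈L ⁅x⁆∉L = grow ⁅ i ⁆ (<-wellFounded _) ⁅i⁆-anchored (pair-not-top i x)
    where
    ⁅i⁆-anchored : Anchored i x ⁅ i ⁆
    ⁅i⁆-anchored = record
      { A∈L = ⁅i⁆∈L
      ; i∈A = x∈⁅x⁆ i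
      ; x∉A = λ x∈⁅i⁆ → ⁅x⁆∉L (subst (λ z → ⁅ z ⁆ ∈ L) (sym (x∈⁅y⁆⇒x≡y i x∈⁅i⁆)) ⁅i⁆∈L)
      ; only-i = λ _ → x∈⁅y⁆⇒x≡y i
      }

    grow : ∀ A → Acc _<_ (n ∸ ∣ A ∣) → Anchored i x A → ¬ ButterflyTop L (A ∪ ⁅ x ⁆) →
           ∃[ A' ] Anchored i x A' × A' ∪ ⁅ x ⁆ ∈ L
    grow A (acc smaller) α ¬top with A ∪ ⁅ x ⁆ ∈? L
    ... | yes A∪x∈L = A , α , A∪x∈L
    ... | no A∪x∉L with bottom-or-top A∪x∉L
    ...   | inj₂ τ = ⊥-elim (¬top τ)
    ...   | inj₁ β = grow (Y β) (smaller (∸-monoʳ-< (partner-larger α β) (∣p∣≤n (Y β))))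
                          (partner-anchored α β) (¬top-under-cap (partner-capped α β))

length-filter-∁ : {A : Set} {P : A → Set} (P? : Decidable P) (xs : List A) →
                  length (filter P? xs) + length (filter (¬? ∘ P?) xs) ≡ length xs
length-filter-∁ P? [] = refl
length-filter-∁ P? (x ∷ xs) with P? x
... | yes _ = cong suc (length-filter-∁ P? xs)
... | no _ = trans (+-suc _ _) (cong suc (length-filter-∁ P? xs))

EdgeIn : ∀ {n} → List (Subset n) → Fin n → Set
EdgeIn P d = ∃[ S ] S ∈ P × d ∉ₛ S × S ∪ ⁅ d ⁆ ∈ P

edgeIn? : ∀ {n} (P : List (Subset n)) → Decidable (EdgeIn P)
edgeIn? P d = map′ find (λ (_ , S∈P , edge) → lose S∈P edge)
                   (any? (λ S → ¬? (d ∈ₛ? S) ×-dec (S ∪ ⁅ d ⁆ ∈? P)) P)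

module _ {m : ℕ} where

  slice : Bool → List (Subset (suc m)) → List (Subset m)
  slice b [] = []
  slice b ((c ∷ s) ∷ P) with c ≟ᵇ b
  ... | yes _ = s ∷ slice b P
  ... | no _ = slice b P

  length-slices : ∀ P → length (slice false P) + length (slice true P) ≡ length P
  length-slices [] = refl
  length-slices ((false ∷ s) ∷ P) = cong suc (length-slices P)
  length-slices ((true ∷ s) ∷ P) = trans (+-suc _ _) (cong suc (length-slices P))

  ∈-slice⁺ : ∀ b {s} P → (b ∷ s) ∈ P → s ∈ slice b P
  ∈-slice⁺ b ((c ∷ t) ∷ P) s∈ with c ≟ᵇ b | s∈
  ... | yes refl | here refl = here refl
  ... | yes refl | there s∈P = there (∈-slice⁺ b P s∈P)
  ... | no c≢b | here refl = ⊥-elim (c≢b refl)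
  ... | no _ | there s∈P = ∈-slice⁺ b P s∈P

  ∈-slice⁻ : ∀ b {s} P → s ∈ slice b P → (b ∷ s) ∈ P
  ∈-slice⁻ b ((c ∷ t) ∷ P) s∈ with c ≟ᵇ b | s∈
  ... | yes refl | here refl = here refl
  ... | yes refl | there s∈ = there (∈-slice⁻ b P s∈)
  ... | no _ | s∈ = there (∈-slice⁻ b P s∈)

  slice-unique : ∀ b {P} → Unique P → Unique (slice b P)
  slice-unique b {[]} [] = []
  slice-unique b {(c ∷ s) ∷ P} (s∉P ∷ P!) with c ≟ᵇ b
  ... | yes refl = ¬Any⇒All¬ _ (All¬⇒¬Any s∉P ∘ ∈-slice⁻ b P) ∷ slice-unique b P!
  ... | no _ = slice-unique b P!

  edge-suc : ∀ P {d} → EdgeIn P (suc d) → EdgeIn (slice false P) d ⊎ EdgeIn (slice true P) d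
  edge-suc P ((false ∷ s) , S∈P , d∉S , S∪d∈P) =
    inj₁ (s , ∈-slice⁺ false P S∈P , d∉S ∘ Vec.there , ∈-slice⁺ false P S∪d∈P)
  edge-suc P ((true ∷ s) , S∈P , d∉S , S∪d∈P) =
    inj₂ (s , ∈-slice⁺ true P S∈P , d∉S ∘ Vec.there , ∈-slice⁺ true P S∪d∈P)

  edge-zero : ∀ P → EdgeIn P zero → 0 < length (slice false P) × 0 < length (slice true P)
  edge-zero P ((false ∷ s) , S∈P , _ , S∪0∈P) = ∈-length (∈-slice⁺ false P S∈P) , ∈-length (∈-slice⁺ true P S∪0∈P)
  edge-zero P ((true ∷ s) , _ , 0∉S , _) = ⊥-elim (0∉S Vec.here)

  predecessors : List (Fin (suc m)) → List (Fin m)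
  predecessors [] = []
  predecessors (zero ∷ D) = predecessors D
  predecessors (suc d ∷ D) = d ∷ predecessors D

  ∈-predecessors⁻ : ∀ {d} D → d ∈ₗ predecessors D → suc d ∈ₗ D
  ∈-predecessors⁻ (zero ∷ D) d∈ = there (∈-predecessors⁻ D d∈)
  ∈-predecessors⁻ (suc d ∷ D) (here refl) = here refl
  ∈-predecessors⁻ (suc d ∷ D) (there d∈) = there (∈-predecessors⁻ D d∈)

  predecessors-unique : ∀ {D} → Unique D → Unique (predecessors D)
  predecessors-unique {[]} [] = []
  predecessors-unique {zero ∷ D} (_ ∷ D!) = predecessors-unique D!
  predecessors-unique {suc d ∷ D} (d∉D ∷ D!) =
    ¬Any⇒All¬ _ (All¬⇒¬Any d∉D ∘ ∈-predecessors⁻ D) ∷ predecessors-unique D!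

  length≤length-predecessors : ∀ D → zero ∉ₗ D → length D ≤ length (predecessors D)
  length≤length-predecessors [] _ = z≤n
  length≤length-predecessors (zero ∷ D) 0∉D = ⊥-elim (0∉D (here refl))
  length≤length-predecessors (suc d ∷ D) 0∉D = s≤s (length≤length-predecessors D (0∉D ∘ there))

  length≤suc-length-predecessors : ∀ {D} → Unique D → length D ≤ suc (length (predecessors D))
  length≤suc-length-predecessors {[]} [] = z≤n
  length≤suc-length-predecessors {zero ∷ D} (0∉D ∷ _) = s≤s (length≤length-predecessors D (All¬⇒¬Any 0∉D))
  length≤suc-length-predecessors {suc d ∷ D} (_ ∷ D!) = s≤s (length≤suc-length-predecessors D!)

pred+pred≤pred[+] : ∀ a b → pred a + pred b ≤ pred (a + b)
pred+pred≤pred[+] zero b = ≤-refl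
pred+pred≤pred[+] (suc a) b = +-monoʳ-≤ a pred[n]≤n

suc[pred+pred]≡pred[+] : ∀ {a b} → 0 < a → 0 < b → suc (pred a + pred b) ≡ pred (a + b)
suc[pred+pred]≡pred[+] {suc a} {suc b} _ _ = sym (+-suc a b)

directions-bound : ∀ {n} (P : List (Subset n)) → Unique P → (D : List (Fin n)) → Unique D →
                   (∀ {d} → d ∈ₗ D → EdgeIn P d) → length D ≤ pred (length P)
directions-bound {zero} P _ [] _ _ = z≤n
directions-bound {suc m} P P! D D! edges =
  subst (λ k → length D ≤ pred k) (length-slices P) (bound (any? (zero ≟ᶠ_) D))
  where
  open ≤-Reasoning
  P₀ P₁ : List (Subset m)
  P₀ = slice false P
  P₁ = slice true P

  D' D₀ D₁ : List (Fin m)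
  D' = predecessors D
  D₀ = filter (edgeIn? P₀) D'
  D₁ = filter (¬? ∘ edgeIn? P₀) D'

  D₀-bound : length D₀ ≤ pred (length P₀)
  D₀-bound = directions-bound P₀ (slice-unique false P!) D₀ (filter⁺ _ (predecessors-unique D!))
               (proj₂ ∘ ∈-filter⁻ (edgeIn? P₀) {xs = D'})

  D₁-bound : length D₁ ≤ pred (length P₁)
  D₁-bound = directions-bound P₁ (slice-unique true P!) D₁ (filter⁺ _ (predecessors-unique D!)) λ d∈D₁ →
    let d∈D' , ¬edge₀ = ∈-filter⁻ (¬? ∘ edgeIn? P₀) {xs = D'} d∈D₁
    in [ ⊥-elim ∘ ¬edge₀ , id ]′ (edge-suc P (edges (∈-predecessors⁻ D d∈D')))

  D'-bound : length D' ≤ pred (length P₀) + pred (length P₁)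
  D'-bound = begin
    length D'               ≡⟨ sym (length-filter-∁ (edgeIn? P₀) D') ⟩
    length D₀ + length D₁   ≤⟨ +-mono-≤ D₀-bound D₁-bound ⟩
    pred (length P₀) + pred (length P₁) ∎

  bound : Dec (zero ∈ₗ D) → length D ≤ pred (length P₀ + length P₁)
  bound (yes 0∈D) with edge-zero P (edges 0∈D)
  ... | P₀≢[] , P₁≢[] = begin
    length D                                   ≤⟨ length≤suc-length-predecessors D! ⟩
    suc (length D')                            ≤⟨ s≤s D'-bound ⟩
    suc (pred (length P₀) + pred (length P₁))  ≡⟨ suc[pred+pred]≡pred[+] P₀≢[] P₁≢[] ⟩
    pred (length P₀ + length P₁)               ∎
  bound (no 0∉D) = begin
    length D                              ≤⟨ length≤length-predecessors D 0∉D ⟩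
    length D'                             ≤⟨ D'-bound ⟩
    pred (length P₀) + pred (length P₁)   ≤⟨ pred+pred≤pred[+] (length P₀) (length P₁) ⟩
    pred (length P₀ + length P₁)          ∎

suc-C2 : ∀ r → suc r C 2 ≡ r + r C 2
suc-C2 r = trans (sym (nCk+nC[k+1]≡[n+1]C[k+1] r 1)) (cong (_+ r C 2) (nC1≡n r))

suc-*-+-C2 : ∀ c r → suc r * c + suc r C 2 ≡ (c + r) + (r * c + r C 2)
suc-*-+-C2 c r = trans (cong (suc r * c +_) (suc-C2 r)) (rearrange c r (r C 2))
  where
  rearrange : ∀ c r x → suc r * c + (r + x) ≡ (c + r) + (r * c + x)
  rearrange = solve-∀

module _ {n : ℕ} where

  Layer : Fin n → List (Fin n) → Subset n → Set
  Layer i E S = i ∈ₛ S × All (_∉ₛ S) E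

  layer? : ∀ i E → Decidable (Layer i E)
  layer? i E S = (i ∈ₛ? S) ×-dec all? (λ e → ¬? (e ∈ₛ? S)) E

  layer : Fin n → List (Fin n) → List (Subset n) → List (Subset n)
  layer i E = filter (layer? i E)

  ∑layers : List (Fin n) → List (Fin n) → List (Subset n) → ℕ
  ∑layers E [] L = 0
  ∑layers E (i ∷ ks) L = length (layer i E L) + ∑layers (i ∷ E) ks L

  ∑layers-[] : ∀ E ks → ∑layers E ks [] ≡ 0
  ∑layers-[] E [] = refl
  ∑layers-[] E (i ∷ ks) = ∑layers-[] (i ∷ E) ks

  ∑layers-skip : ∀ {S} E ks L → Any (_∈ₛ S) E → ∑layers E ks (S ∷ L) ≡ ∑layers E ks L
  ∑layers-skip E [] L _ = refl
  ∑layers-skip E (i ∷ ks) L hit =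
    cong₂ _+_ (cong length (filter-reject (layer? i E) (λ (_ , E∉S) → All¬⇒¬Any E∉S hit)))
              (∑layers-skip (i ∷ E) ks L (there hit))

  ∑layers-cons : ∀ {S} E ks L → ∑layers E ks (S ∷ L) ≤ suc (∑layers E ks L)
  ∑layers-cons E [] L = z≤n
  ∑layers-cons {S} E (i ∷ ks) L with layer? i E S
  ... | yes S∈layer@(i∈S , _) =
    ≤-reflexive (cong₂ _+_ (cong length (filter-accept (layer? i E) S∈layer))
                           (∑layers-skip (i ∷ E) ks L (here i∈S)))
  ... | no S∉layer = begin
    length (layer i E (S ∷ L)) + ∑layers (i ∷ E) ks (S ∷ L)
      ≡⟨ cong (λ P → length P + ∑layers (i ∷ E) ks (S ∷ L)) (filter-reject (layer? i E) S∉layer) ⟩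
    length (layer i E L) + ∑layers (i ∷ E) ks (S ∷ L)
      ≤⟨ +-monoʳ-≤ (length (layer i E L)) (∑layers-cons (i ∷ E) ks L) ⟩
    length (layer i E L) + suc (∑layers (i ∷ E) ks L)
      ≡⟨ +-suc _ _ ⟩
    suc (length (layer i E L) + ∑layers (i ∷ E) ks L) ∎
    where open ≤-Reasoning

  ∑layers≤length : ∀ E ks L → ∑layers E ks L ≤ length L
  ∑layers≤length E ks [] = ≤-reflexive (∑layers-[] E ks)
  ∑layers≤length E ks (S ∷ L) = ≤-trans (∑layers-cons E ks L) (s≤s (∑layers≤length E ks L))

module _ {n : ℕ} (F : Family n) (saturated : BSaturated F) where
  open Saturated (proj₁ saturated) (proj₂ saturated)
  open ≤-Reasoning

  private
    L : List (Subset n)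
    L = sets F

  Singleton : Fin n → Set
  Singleton i = ⁅ i ⁆ ∈ L

  singleton? : Decidable Singleton
  singleton? i = ⁅ i ⁆ ∈? L

  singletons nonSingletons : List (Fin n)
  singletons = filter singleton? (allFin n)
  nonSingletons = filter (¬? ∘ singleton?) (allFin n)

  module _ {i : Fin n} {E rest : List (Fin n)} (E-singletons : All Singleton E)
           (ks-singletons : All Singleton (i ∷ rest)) (ks! : Unique (i ∷ rest)) (E#ks : Disjoint E (i ∷ rest)) where

    private
      ⁅i⁆∈L : Singleton i
      ⁅i⁆∈L = lookup ks-singletons (here refl)

      i∉rest : i ∉ₗ rest
      i∉rest = All¬⇒¬Any (head ks!)

    in-layer : ∀ {S} → S ∈ L → i ∈ₛ S → (∀ {e} → Singleton e → e ∈ₛ S → e ∈ₗ i ∷ rest) → S ∈ layer i E L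
    in-layer S∈L i∈S singletons-in-ks = ∈-filter⁺ (layer? i E) S∈L
      (i∈S , tabulate λ e∈E e∈S → E#ks (e∈E , singletons-in-ks (lookup E-singletons e∈E) e∈S))

    nonSingleton-edge : ∀ {d} → ¬ Singleton d → EdgeIn (layer i E L) d
    nonSingleton-edge {d} ⁅d⁆∉L with anchored-edge ⁅i⁆∈L ⁅d⁆∉L
    ... | A , α , A∪d∈L = A , in-layer A∈L i∈A (λ ⁅e⁆∈L → here ∘ only-i ⁅e⁆∈L) , x∉A ,
      in-layer A∪d∈L (p⊆p∪q ⁅ d ⁆ i∈A) λ ⁅e⁆∈L e∈A∪d →
        [ here ∘ only-i ⁅e⁆∈L , (λ { refl → ⊥-elim (⁅d⁆∉L ⁅e⁆∈L) }) ]′ (∈-∪⁅⁆⁻ A e∈A∪d)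
      where open Anchored α

    rest-edge : ∀ {d} → d ∈ₗ rest → EdgeIn (layer i E L) d
    rest-edge {d} d∈rest = ⁅ i ⁆ , in-layer ⁅i⁆∈L (x∈⁅x⁆ i) (λ _ → here ∘ x∈⁅y⁆⇒x≡y i) ,
      (λ d∈⁅i⁆ → i∉rest (subst (_∈ₗ rest) (x∈⁅y⁆⇒x≡y i d∈⁅i⁆) d∈rest)) ,
      in-layer (pair∈ ⁅i⁆∈L ⁅d⁆∈L) (p⊆p∪q ⁅ d ⁆ (x∈⁅x⁆ i)) λ _ e∈pair →
        [ here ∘ x∈⁅y⁆⇒x≡y i , (λ { refl → there d∈rest }) ]′ (∈-∪⁅⁆⁻ ⁅ i ⁆ e∈pair)
      where
      ⁅d⁆∈L : Singleton d
      ⁅d⁆∈L = lookup ks-singletons (there d∈rest)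

    layer-size : length nonSingletons + length rest ≤ length (layer i E L)
    layer-size = begin
      length nonSingletons + length rest   ≡⟨ sym (length-++ nonSingletons) ⟩
      length (nonSingletons ++ rest)       ≤⟨ directions-bound (layer i E L) (filter⁺ (layer? i E) (unique F))
                                                (nonSingletons ++ rest) directions! edges ⟩
      pred (length (layer i E L))          ≤⟨ pred[n]≤n ⟩
      length (layer i E L)                 ∎
      where
      directions! : Unique (nonSingletons ++ rest)
      directions! = ++⁺ (filter⁺ (¬? ∘ singleton?) (allFin⁺ n)) (tail ks!) λ (d∈non , d∈rest) →
        proj₂ (∈-filter⁻ (¬? ∘ singleton?) {xs = allFin n} d∈non) (lookup ks-singletons (there d∈rest))

      edges : ∀ {d} → d ∈ₗ nonSingletons ++ rest → EdgeIn (layer i E L) d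
      edges d∈ = [ nonSingleton-edge ∘ proj₂ ∘ ∈-filter⁻ (¬? ∘ singleton?) {xs = allFin n} , rest-edge ]′
                   (∈-++⁻ nonSingletons d∈)

  layers-bound : ∀ E ks → All Singleton E → All Singleton ks → Unique ks → Disjoint E ks →
                 length ks * length nonSingletons + length ks C 2 ≤ ∑layers E ks L
  layers-bound E [] _ _ _ _ = z≤n
  layers-bound E (i ∷ rest) E-singletons ks-singletons@(⁅i⁆∈L ∷ rest-singletons) ks!@(i∉rest ∷ rest!) E#ks =
    begin
      suc r * c + suc r C 2       ≡⟨ suc-*-+-C2 c r ⟩
      (c + r) + (r * c + r C 2)   ≤⟨ +-mono-≤ (layer-size E-singletons ks-singletons ks! E#ks)
                                     (layers-bound (i ∷ E) rest (⁅i⁆∈L ∷ E-singletons) rest-singletons rest! iE#rest) ⟩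
      ∑layers E (i ∷ rest) L      ∎
    where
    c r : ℕ
    c = length nonSingletons
    r = length rest

    iE#rest : Disjoint (i ∷ E) rest
    iE#rest (here refl , i∈rest) = All¬⇒¬Any i∉rest i∈rest
    iE#rest (there e∈E , e∈rest) = E#ks (e∈E , there e∈rest)

  size-bound : numSingletons F C 2 + numSingletons F * (n ∸ numSingletons F) ≤ ∣ F ∣F
  size-bound = begin
    k C 2 + k * (n ∸ k)       ≡⟨ cong (λ m → k C 2 + k * m) n∸k≡c ⟩
    k C 2 + k * c             ≡⟨ +-comm (k C 2) (k * c) ⟩
    k * c + k C 2             ≤⟨ layers-bound [] singletons [] all-singletons (filter⁺ singleton? (allFin⁺ n)) (λ ()) ⟩
    ∑layers [] singletons L   ≤⟨ ∑layers≤length [] singletons L ⟩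
    length L                  ∎
    where
    k c : ℕ
    k = length singletons
    c = length nonSingletons

    n∸k≡c : n ∸ k ≡ c
    n∸k≡c = trans (cong (_∸ k) (sym (trans (length-filter-∁ singleton? (allFin n)) (length-tabulate (λ i → i)))))
                  (m+n∸m≡n k c)

    all-singletons : All Singleton singletons
    all-singletons = tabulate (proj₂ ∘ ∈-filter⁻ singleton? {xs = allFin n})

theorem3 : (n k : ℕ) → 1 ≤ n → 1 ≤ k → (F : Family n) → BSaturated F →
    numSingletons F ≡ k → k C 2 + k * (n ∸ k) ≤ ∣ F ∣F
theorem3 n _ _ _ F saturated refl = size-bound F saturated
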